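{- Let $k$ be an integer, let $G$ be a non-complete double-critical $k$-chromatic graph, and let $H$ be a connected subgraph of $G$ with at least $2$ vertices. Then the graph $G/V(H)$ obtained from $G$ by contracting $V(H)$ into a single vertex is $(k-1)$-colourable.
   Context: All graphs are finite and simple. A graph $G$ is (vertex-)critical if $\chi(G-v)<\chi(G)$ for every vertex $v$. A critical graph $G$ is double-critical if $\chi(G-x-y)\le \chi(G)-2$ for every edge $xy\in E(G)$ (here $G-x-y$ denotes deletion of both end-vertices). For $U\subseteq V(G)$ with $G[U]$ connected, $G/U$ is the (simple) graph obtained by contracting $U$ into one vertex. -}

module Defs where

open import Data.Nat using (ℕ; _<_; _≤_; _∸_)
open import Data.Fin using (Fin)
open import Data.Maybe using (Maybe; just; nothing)
open import Data.Product using (Σ; ∃; ∃-syntax; _×_; _,_; proj₁; proj₂)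
open import Data.Empty using (⊥)
open import Relation.Nullary using (¬_)
open import Relation.Binary.PropositionalEquality using (_≡_; _≢_; refl; cong)
open import Relation.Binary.Construct.Closure.ReflexiveTransitive using (Star)

record Graph (V : Set) : Set₁ where
  field
    E     : V → V → Set
    sym   : ∀ {u v} → E u v → E v u
    irrefl : ∀ {v} → ¬ E v v
open Graph public

Colourable : {V : Set} → ℕ → Graph V → Set
Colourable {V} m G = Σ (V → Fin m) λ c → ∀ u v → E G u v → c u ≢ c v

HasChromaticNumber : {V : Set} → Graph V → ℕ → Set
HasChromaticNumber G k = Colourable k G × (∀ m → m < k → ¬ Colourable m G)

Induced : {V : Set} → Graph V → (P : V → Set) → Graph (Σ V P)
Induced G P = record
  { E = λ a b → E G (proj₁ a) (proj₁ b)
  ; sym = sym G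
  ; irrefl = irrefl G }

deleteV : {V : Set} → Graph V → (v : V) → Graph (Σ V λ u → u ≢ v)
deleteV G v = Induced G (λ u → u ≢ v)

deleteVV : {V : Set} → Graph V → (x y : V) → Graph (Σ V λ u → u ≢ x × u ≢ y)
deleteVV G x y = Induced G (λ u → u ≢ x × u ≢ y)

Critical : {n : ℕ} → Graph (Fin n) → ℕ → Set
Critical {n} G k = HasChromaticNumber G k ×
  (∀ (v : Fin n) → ∃[ m ] (m < k × Colourable m (deleteV G v)))

DoubleCritical : {n : ℕ} → Graph (Fin n) → ℕ → Set
DoubleCritical {n} G k = Critical G k ×
  (∀ (x y : Fin n) → E G x y → ∃[ m ] (m ≤ k ∸ 2 × Colourable m (deleteVV G x y)))

Complete : {n : ℕ} → Graph (Fin n) → Set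
Complete {n} G = ∀ (u v : Fin n) → u ≢ v → E G u v

record Subgraph {n : ℕ} (G : Graph (Fin n)) : Set₁ where
  field
    VH : Fin n → Set
    EH : Fin n → Fin n → Set
    EH-sym : ∀ {u v} → EH u v → EH v u
    EH-ends : ∀ {u v} → EH u v → VH u × VH v
    EH-sub : ∀ {u v} → EH u v → E G u v
open Subgraph public

ConnectedSub : {n : ℕ} {G : Graph (Fin n)} → Subgraph G → Set
ConnectedSub H = ∀ u v → VH H u → VH H v → Star (EH H) u v

AtLeastTwoVertices : {n : ℕ} {G : Graph (Fin n)} → Subgraph G → Set
AtLeastTwoVertices H = ∃[ u ] ∃[ v ] (u ≢ v × VH H u × VH H v)

-- Contraction G/U: vertex "nothing" is the contracted vertex,
-- "just (v , _)" is a vertex v outside U.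
ContrV : {n : ℕ} → (Fin n → Set) → Set
ContrV {n} U = Maybe (Σ (Fin n) λ v → ¬ U v)

ContrE : {n : ℕ} (G : Graph (Fin n)) (U : Fin n → Set) → ContrV U → ContrV U → Set
ContrE G U nothing nothing = ⊥
ContrE G U nothing (just (v , _)) = ∃[ u ] (U u × E G u v)
ContrE G U (just (v , _)) nothing = ∃[ u ] (U u × E G v u)
ContrE G U (just (a , _)) (just (b , _)) = E G a b

private
  contrSym : {n : ℕ} (G : Graph (Fin n)) (U : Fin n → Set) →
    ∀ {a b} → ContrE G U a b → ContrE G U b a
  contrSym G U {nothing} {just _} (u , Uu , e) = u , Uu , sym G e
  contrSym G U {just _} {nothing} (u , Uu , e) = u , Uu , sym G e
  contrSym G U {just _} {just _} e = sym G e

  contrIrr : {n : ℕ} (G : Graph (Fin n)) (U : Fin n → Set) →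
    ∀ {a} → ¬ ContrE G U a a
  contrIrr G U {nothing} ()
  contrIrr G U {just _} e = irrefl G e

_／_ : {n : ℕ} (G : Graph (Fin n)) (U : Fin n → Set) → Graph (ContrV U)
G ／ U = record { E = ContrE G U ; sym = λ {a} {b} → contrSym G U {a} {b} ; irrefl = λ {a} → contrIrr G U {a} }

module Submission where

-- Since H is connected and has two distinct vertices, it
-- contains an edge uw of G.  Double-criticality gives a colouring of G - u - w
-- with m ≤ k - 2 colours.  Every vertex of G / V(H) other than the contracted
-- vertex lies outside V(H), hence differs from u and w, so it keeps its colour;
-- the contracted vertex receives one fresh colour.  This properly colours
-- G / V(H) with m + 1 colours, and m + 1 ≤ k - 1 because G, having an edge,
-- needs at least two colours.

open import Defs
open import Data.Nat using (ℕ; _∸_; suc; zero; _≤_; z≤n; s≤s)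
open import Data.Fin using (Fin; fromℕ; inject₁; inject≤)
open import Data.Fin.Properties using (fromℕ≢inject₁; inject₁-injective; inject≤-injective)
open import Data.Maybe using (just; nothing)
open import Data.Product using (∃-syntax; _×_; _,_; proj₁; proj₂)
open import Data.Empty using (⊥-elim)
open import Relation.Nullary using (¬_)
open import Relation.Binary.PropositionalEquality using (_≢_; refl; subst) renaming (sym to ≡-sym)
open import Relation.Binary.Construct.Closure.ReflexiveTransitive using (Star; ε; _◅_)

star-first-step : {A : Set} {R : A → A → Set} {u v : A} →
  u ≢ v → Star R u v → ∃[ w ] R u w
star-first-step u≢v ε = ⊥-elim (u≢v refl)
star-first-step u≢v (r ◅ _) = _ , r

connected-sub-edge : {n : ℕ} {G : Graph (Fin n)} (H : Subgraph G) →
  ConnectedSub H → AtLeastTwoVertices H →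
  ∃[ u ] ∃[ w ] (VH H u × VH H w × E G u w)
connected-sub-edge H conn (u , v , u≢v , Hu , Hv)
  with star-first-step u≢v (conn u v Hu Hv)
... | w , uw = u , w , Hu , proj₂ (EH-ends H uw) , EH-sub H uw

colourable-mono : {V : Set} {G : Graph V} {m m′ : ℕ} →
  m ≤ m′ → Colourable m G → Colourable m′ G
colourable-mono m≤m′ (c , proper) =
  (λ v → inject≤ (c v) m≤m′) ,
  (λ u v uv eq → proper u v uv (inject≤-injective m≤m′ m≤m′ (c u) (c v) eq))

distinct-Fin⇒2≤ : {k : ℕ} (a b : Fin k) → a ≢ b → 2 ≤ k
distinct-Fin⇒2≤ {suc (suc _)} _ _ _ = s≤s (s≤s z≤n)
distinct-Fin⇒2≤ {suc zero} Fin.zero Fin.zero a≢b = ⊥-elim (a≢b refl)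

edge⇒2≤colours : {V : Set} {G : Graph V} {k : ℕ} {u w : V} →
  E G u w → Colourable k G → 2 ≤ k
edge⇒2≤colours {u = u} {w} uw (c , proper) =
  distinct-Fin⇒2≤ (c u) (c w) (proper u w uw)

suc-≤-pred : {m k : ℕ} → 2 ≤ k → m ≤ k ∸ 2 → suc m ≤ k ∸ 1
suc-≤-pred (s≤s (s≤s z≤n)) m≤k∸2 = s≤s m≤k∸2

contraction-colouring : {n m : ℕ} (G : Graph (Fin n)) (U : Fin n → Set) {x y : Fin n} →
  U x → U y → Colourable m (deleteVV G x y) → Colourable (suc m) (G ／ U)
contraction-colouring {m = m} G U {x} {y} Ux Uy (d , d-proper) = colour , proper
  where
  outside : ∀ {v} → ¬ U v → v ≢ x × v ≢ y
  outside ¬Uv = (λ v≡x → ¬Uv (subst U (≡-sym v≡x) Ux))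
              , (λ v≡y → ¬Uv (subst U (≡-sym v≡y) Uy))

  colour : ContrV U → Fin (suc m)
  colour nothing = fromℕ m
  colour (just (v , ¬Uv)) = inject₁ (d (v , outside ¬Uv))

  proper : ∀ a b → E (G ／ U) a b → colour a ≢ colour b
  proper nothing (just _) _ = fromℕ≢inject₁
  proper (just _) nothing _ eq = fromℕ≢inject₁ (≡-sym eq)
  proper (just (a , ¬Ua)) (just (b , ¬Ub)) ab eq =
    d-proper (a , outside ¬Ua) (b , outside ¬Ub) ab (inject₁-injective eq)

proposition3 : (k n : ℕ) (G : Graph (Fin n)) → ¬ Complete G → DoubleCritical G k →
    (H : Subgraph G) → ConnectedSub H → AtLeastTwoVertices H →
    Colourable (k ∸ 1) (G ／ VH H)
proposition3 k n G _ (((k-colouring , _) , _) , double) H conn two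
  with connected-sub-edge H conn two
... | u , w , Hu , Hw , uw
  with double u w uw
... | m , m≤k∸2 , colouring-G-u-w =
  colourable-mono {G = G ／ VH H} enough-colours
    (contraction-colouring G (VH H) Hu Hw colouring-G-u-w)
  where
  enough-colours : suc m ≤ k ∸ 1
  enough-colours = suc-≤-pred (edge⇒2≤colours {G = G} uw k-colouring) m≤k∸2
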